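{- Assume that for every object $X$ of $\mathbf{C}$ a free uniform-iteration algebra $KX$ exists and is stable, and let $\mathbb{K}$ be the induced monad. Then $\mathbb{K}$ is a strong monad, and the components of its strength $\tau\colon X\times KY\to K(X\times Y)$ are uniquely determined by the conditions $\tau(\mathrm{id}\times\eta)=\eta$ and $\tau(\mathrm{id}\times h^\dagger)=((\tau+\mathrm{id})\,\mathrm{dstr}\,(\mathrm{id}\times h))^\dagger$ for all $h\colon Z\to KY+Z$.
   Context: $\mathbf{C}$ is an extensive category with finite products, a stable natural number object and exponentials $X^{\mathbb{N}}$; $\mathrm{dstr}$ is the canonical distributivity isomorphism $X\times(B+Z)\to X\times B+X\times Z$. A uniform-iteration algebra is an object $A$ with an operator $f\mapsto f^\dagger$ ($f\colon Z\to A+Z$, $f^\dagger\colon Z\to A$) satisfying (Fixpoint) $f^\dagger=[\mathrm{id},f^\dagger]f$ and (Uniformity) $(\mathrm{id}+h)f=gh\Rightarrow f^\dagger=g^\dagger h$; morphisms $h$ satisfy $hf^\dagger=((h+\mathrm{id})f)^\dagger$. $KX$ with unit $\eta\colon X\to KX$ is free on $X$. $KY$ is stable if for every $X$, $\mathrm{fst}\colon X\times KY\to X$ with $\mathrm{id}\times\eta$ is a free uniform-iteration algebra over $\mathrm{fst}\colon X\times Y\to X$ in the slice $\mathbf{C}/X$ (structure induced by $KY$). The monad $\mathbb{K}$ has unit $\eta$ and Kleisli lifting of $f\colon X\to KY$ the unique algebra morphism $f^*\colon KX\to KY$ with $f^*\eta=f$. -}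

module Defs where

open import Level using (Level; _⊔_) renaming (suc to lsuc)
open import Relation.Binary.PropositionalEquality using (_≡_)
open import Data.Product using (Σ; _,_; proj₁; proj₂) renaming (_×_ to _∧_)

record Category (o ℓ : Level) : Set (lsuc (o ⊔ ℓ)) where
  infixr 9 _∘_
  infix 4 _⇒_
  field
    Obj : Set o
    _⇒_ : Obj → Obj → Set ℓ
    id  : ∀ {A} → A ⇒ A
    _∘_ : ∀ {A B D} → B ⇒ D → A ⇒ B → A ⇒ D
    identityˡ : ∀ {A B} {f : A ⇒ B} → id ∘ f ≡ f
    identityʳ : ∀ {A B} {f : A ⇒ B} → f ∘ id ≡ f
    assoc : ∀ {A B D E} {f : A ⇒ B} {g : B ⇒ D} {h : D ⇒ E} →
            (h ∘ g) ∘ f ≡ h ∘ (g ∘ f)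

Unique : ∀ {a p} {A : Set a} → (A → Set p) → Set (a ⊔ p)
Unique {A = A} P = Σ A λ x → P x ∧ (∀ y → P y → y ≡ x)

module _ {o ℓ : Level} (C : Category o ℓ) where
  open Category C

  record Terminal : Set (o ⊔ ℓ) where
    field
      ⊤ : Obj
      ! : ∀ {A} → A ⇒ ⊤
      !-unique : ∀ {A} (f : A ⇒ ⊤) → f ≡ !

  record BinaryProducts : Set (o ⊔ ℓ) where
    infixr 7 _×_
    infixr 8 _⁂_
    field
      _×_ : Obj → Obj → Obj
      fst : ∀ {A B} → A × B ⇒ A
      snd : ∀ {A B} → A × B ⇒ B
      ⟨_,_⟩ : ∀ {W A B} → W ⇒ A → W ⇒ B → W ⇒ A × B
      fst-⟨⟩ : ∀ {W A B} {f : W ⇒ A} {g : W ⇒ B} → fst ∘ ⟨ f , g ⟩ ≡ f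
      snd-⟨⟩ : ∀ {W A B} {f : W ⇒ A} {g : W ⇒ B} → snd ∘ ⟨ f , g ⟩ ≡ g
      ⟨⟩-unique : ∀ {W A B} {f : W ⇒ A} {g : W ⇒ B} (h : W ⇒ A × B) →
                  fst ∘ h ≡ f → snd ∘ h ≡ g → h ≡ ⟨ f , g ⟩
    _⁂_ : ∀ {A B A' B'} → A ⇒ A' → B ⇒ B' → A × B ⇒ A' × B'
    f ⁂ g = ⟨ f ∘ fst , g ∘ snd ⟩
    assocʳ : ∀ {A B D} → (A × B) × D ⇒ A × (B × D)
    assocʳ = ⟨ fst ∘ fst , ⟨ snd ∘ fst , snd ⟩ ⟩

  record Coproducts : Set (o ⊔ ℓ) where
    infixr 6 _+_
    infixr 7 _⊕_
    field
      ⊥ : Obj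
      ¡ : ∀ {A} → ⊥ ⇒ A
      ¡-unique : ∀ {A} (f : ⊥ ⇒ A) → f ≡ ¡
      _+_ : Obj → Obj → Obj
      inl : ∀ {A B} → A ⇒ A + B
      inr : ∀ {A B} → B ⇒ A + B
      [_,_] : ∀ {A B W} → A ⇒ W → B ⇒ W → A + B ⇒ W
      inl-[] : ∀ {A B W} {f : A ⇒ W} {g : B ⇒ W} → [ f , g ] ∘ inl ≡ f
      inr-[] : ∀ {A B W} {f : A ⇒ W} {g : B ⇒ W} → [ f , g ] ∘ inr ≡ g
      []-unique : ∀ {A B W} {f : A ⇒ W} {g : B ⇒ W} (h : A + B ⇒ W) →
                  h ∘ inl ≡ f → h ∘ inr ≡ g → h ≡ [ f , g ]
    _⊕_ : ∀ {A B A' B'} → A ⇒ A' → B ⇒ B' → A + B ⇒ A' + B'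
    f ⊕ g = [ inl ∘ f , inr ∘ g ]

  IsPullback : ∀ {P A B Z} → P ⇒ A → P ⇒ B → A ⇒ Z → B ⇒ Z → Set (o ⊔ ℓ)
  IsPullback {P} {A} {B} p q f g =
    (f ∘ p ≡ g ∘ q) ∧
    (∀ {W} (a : W ⇒ A) (b : W ⇒ B) → f ∘ a ≡ g ∘ b →
       Unique λ (u : W ⇒ P) → (p ∘ u ≡ a) ∧ (q ∘ u ≡ b))

  IsCoproduct : ∀ {X Y Z} → X ⇒ Z → Y ⇒ Z → Set (o ⊔ ℓ)
  IsCoproduct {X} {Y} {Z} m n =
    ∀ {W} (a : X ⇒ W) (b : Y ⇒ W) →
      Unique λ (u : Z ⇒ W) → (u ∘ m ≡ a) ∧ (u ∘ n ≡ b)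

  record Extensive (S : Coproducts) : Set (o ⊔ ℓ) where
    open Coproducts S
    field
      pullback-inl : ∀ {A B Z} (h : Z ⇒ A + B) →
        Σ Obj λ P → Σ (P ⇒ A) λ p → Σ (P ⇒ Z) λ q → IsPullback p q inl h
      pullback-inr : ∀ {A B Z} (h : Z ⇒ A + B) →
        Σ Obj λ P → Σ (P ⇒ B) λ p → Σ (P ⇒ Z) λ q → IsPullback p q inr h
      extensive : ∀ {A B X Y Z} (x : X ⇒ A) (y : Y ⇒ B) (m : X ⇒ Z) (n : Y ⇒ Z)
        (h : Z ⇒ A + B) → inl ∘ x ≡ h ∘ m → inr ∘ y ≡ h ∘ n →
        (IsCoproduct m n → IsPullback x m inl h ∧ IsPullback y n inr h) ∧
        (IsPullback x m inl h ∧ IsPullback y n inr h → IsCoproduct m n)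

  record Distributivity (P : BinaryProducts) (S : Coproducts) : Set (o ⊔ ℓ) where
    open BinaryProducts P
    open Coproducts S
    field
      dstr : ∀ {X B Z} → X × (B + Z) ⇒ X × B + X × Z
      dstr-inverseˡ : ∀ {X B Z} → dstr {X} {B} {Z} ∘ [ id ⁂ inl , id ⁂ inr ] ≡ id
      dstr-inverseʳ : ∀ {X B Z} → [ id ⁂ inl , id ⁂ inr ] ∘ dstr {X} {B} {Z} ≡ id

  record StableNNO (T : Terminal) (P : BinaryProducts) : Set (o ⊔ ℓ) where
    open Terminal T
    open BinaryProducts P
    field
      N : Obj
      z : ⊤ ⇒ N
      s : N ⇒ N
      iter : ∀ {X A} (f : X ⇒ A) (g : A ⇒ A) →
        Unique λ (h : X × N ⇒ A) → (h ∘ ⟨ id , z ∘ ! ⟩ ≡ f) ∧ (h ∘ (id ⁂ s) ≡ g ∘ h)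

  record ExponentialsBy (P : BinaryProducts) (N : Obj) : Set (o ⊔ ℓ) where
    open BinaryProducts P
    field
      _^N : Obj → Obj
      ev : ∀ {X} → (X ^N) × N ⇒ X
      curry : ∀ {X W} (f : W × N ⇒ X) →
        Unique λ (g : W ⇒ (X ^N)) → ev ∘ (g ⁂ id) ≡ f

  module _ (S : Coproducts) where
    open Coproducts S

    record UIA (A : Obj) : Set (o ⊔ ℓ) where
      field
        _† : ∀ {Z} → Z ⇒ A + Z → Z ⇒ A
        fixpoint : ∀ {Z} {f : Z ⇒ A + Z} → f † ≡ [ id , f † ] ∘ f
        uniformity : ∀ {Z W} {f : Z ⇒ A + Z} {g : W ⇒ A + W} {h : Z ⇒ W} →
          (id ⊕ h) ∘ f ≡ g ∘ h → f † ≡ (g †) ∘ h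

    IsUIAMorphism : ∀ {A B} → UIA A → UIA B → A ⇒ B → Set (o ⊔ ℓ)
    IsUIAMorphism {A} {B} α β h =
      ∀ {Z} (f : Z ⇒ A + Z) → h ∘ UIA._† α f ≡ UIA._† β ((h ⊕ id) ∘ f)

    record FreeUIA (X : Obj) : Set (o ⊔ ℓ) where
      field
        K : Obj
        η : X ⇒ K
        alg : UIA K
        free : ∀ {B} (β : UIA B) (f : X ⇒ B) →
          Unique λ (h : K ⇒ B) → IsUIAMorphism alg β h ∧ (h ∘ η ≡ f)

    -- An object is (A , p : A ⇒ X); coproducts in C/X are
    -- (A + Z , [ p , r ]). The iteration operator takes f : (Z , r) → (A + Z , [ p , r ]),
    -- i.e. f : Z ⇒ A + Z with [ p , r ] ∘ f ≡ r.  For convenience the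
    -- operator is given on all f (its value on non-slice morphisms is
    -- irrelevant: no law or condition mentions it).
    SliceDagger : (X A : Obj) → Set (o ⊔ ℓ)
    SliceDagger X A = ∀ {Z} → Z ⇒ X → Z ⇒ A + Z → Z ⇒ A

    record SliceUIA (X A : Obj) (p : A ⇒ X) : Set (o ⊔ ℓ) where
      field
        dag : SliceDagger X A
        over : ∀ {Z} {r : Z ⇒ X} {f : Z ⇒ A + Z} → [ p , r ] ∘ f ≡ r →
          p ∘ dag r f ≡ r
        fixpoint : ∀ {Z} {r : Z ⇒ X} {f : Z ⇒ A + Z} → [ p , r ] ∘ f ≡ r →
          dag r f ≡ [ id , dag r f ] ∘ f
        uniformity : ∀ {Z W} {r : Z ⇒ X} {t : W ⇒ X}
          {f : Z ⇒ A + Z} {g : W ⇒ A + W} {h : Z ⇒ W} →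
          [ p , r ] ∘ f ≡ r → [ p , t ] ∘ g ≡ t → t ∘ h ≡ r →
          (id ⊕ h) ∘ f ≡ g ∘ h → dag r f ≡ dag t g ∘ h

    IsSliceUIAMorphism : ∀ {X A B} (p : A ⇒ X) → SliceDagger X A → SliceDagger X B →
      A ⇒ B → Set (o ⊔ ℓ)
    IsSliceUIAMorphism {X} {A} {B} p α β h =
      ∀ {Z} (r : Z ⇒ X) (f : Z ⇒ A + Z) → [ p , r ] ∘ f ≡ r →
        h ∘ α r f ≡ β r ((h ⊕ id) ∘ f)

    module _ (P : BinaryProducts) where
      open BinaryProducts P

      inducedDagger : ∀ {Y} (F : FreeUIA Y) (X : Obj) → SliceDagger X (X × FreeUIA.K F)
      inducedDagger F X r f = ⟨ r , UIA._† (FreeUIA.alg F) ((snd ⊕ id) ∘ f) ⟩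

      Stable : ∀ {Y} → FreeUIA Y → Set (o ⊔ ℓ)
      Stable {Y} F = ∀ (X : Obj) {B} {q : B ⇒ X} (β : SliceUIA X B q)
        (g : X × Y ⇒ B) → q ∘ g ≡ fst →
        Unique λ (h : X × FreeUIA.K F ⇒ B) →
          (q ∘ h ≡ fst) ∧
          IsSliceUIAMorphism fst (inducedDagger F X) (SliceUIA.dag β) h ∧
          (h ∘ (id ⁂ FreeUIA.η F) ≡ g)

      module Induced (T : Terminal) (D : Distributivity P S)
                     (Kf : (X : Obj) → FreeUIA X) where
        open Terminal T
        open Distributivity D

        K : Obj → Obj
        K X = FreeUIA.K (Kf X)

        η : ∀ {X} → X ⇒ K X
        η {X} = FreeUIA.η (Kf X)

        _† : ∀ {X Z} → Z ⇒ K X + Z → Z ⇒ K X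
        _† {X} = UIA._† (FreeUIA.alg (Kf X))

        _* : ∀ {X Y} → X ⇒ K Y → K X ⇒ K Y
        _* {X} {Y} f = proj₁ (FreeUIA.free (Kf X) (FreeUIA.alg (Kf Y)) f)

        Kmap : ∀ {X Y} → X ⇒ Y → K X ⇒ K Y
        Kmap f = (η ∘ f) *

        MonadLaws : Set (o ⊔ ℓ)
        MonadLaws =
          (∀ {X Y} (f : X ⇒ K Y) → (f *) ∘ η ≡ f) ∧
          (∀ {X} → (η {X}) * ≡ id) ∧
          (∀ {X Y W} (f : X ⇒ K Y) (g : Y ⇒ K W) → ((g *) ∘ f) * ≡ (g *) ∘ (f *))

        Strength : Set (o ⊔ ℓ)
        Strength = ∀ X Y → X × K Y ⇒ K (X × Y)

        StrengthLaws : Strength → Set (o ⊔ ℓ)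
        StrengthLaws τ =
          (∀ {X X' Y Y'} (f : X ⇒ X') (g : Y ⇒ Y') →
             τ X' Y' ∘ (f ⁂ Kmap g) ≡ Kmap (f ⁂ g) ∘ τ X Y) ∧
          (∀ {Y} → Kmap snd ∘ τ ⊤ Y ≡ snd) ∧
          (∀ {X Y W} → Kmap assocʳ ∘ τ (X × Y) W ≡ τ X (Y × W) ∘ (id ⁂ τ Y W) ∘ assocʳ) ∧
          (∀ {X Y} → τ X Y ∘ (id ⁂ η) ≡ η) ∧
          (∀ {X Y W} (f : Y ⇒ K W) →
             τ X W ∘ (id ⁂ (f *)) ≡ ((τ X W ∘ (id ⁂ f)) *) ∘ τ X Y)

        Characterisation : (X Y : Obj) → X × K Y ⇒ K (X × Y) → Set (o ⊔ ℓ)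
        Characterisation X Y t =
          (t ∘ (id ⁂ η) ≡ η) ∧
          (∀ {Z} (h : Z ⇒ K Y + Z) →
             t ∘ (id ⁂ (h †)) ≡ (((t ⊕ id) ∘ dstr ∘ (id ⁂ h)) †))

        Conclusion : Set (o ⊔ ℓ)
        Conclusion =
          MonadLaws ∧
          Σ Strength λ τ →
            StrengthLaws τ ∧
            (∀ X Y → Characterisation X Y (τ X Y) ∧
                     (∀ t → Characterisation X Y t → t ≡ τ X Y))

-- Call u : X × B ⇒ A strong when it is a morphism of uniform-iteration
-- algebras in its second argument, X being carried along through dstr.
-- Stability of KY says exactly that strong maps X × KY ⇒ A, for any
-- uniform-iteration algebra A, correspond to arbitrary maps X × Y ⇒ A by
-- restriction along id × η: a strong map u gives the slice morphism ⟨ fst , u ⟩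
-- into the slice algebra fst : X × A ⇒ X, and the second component of a slice
-- morphism is strong. The strength τ is the strong extension of η; each law of
-- a strong monad compares two composites which are strong (strong maps are
-- closed under post-composition with algebra morphisms, pre-composition with
-- f × m for an algebra morphism m, and the associativity composite) and agree
-- on id × η, so it holds by uniqueness of strong extensions.

module Submission where

open import Defs
open import Level using (Level; _⊔_)
open import Relation.Binary.PropositionalEquality using (_≡_; refl; sym; trans; cong; cong₂; module ≡-Reasoning)
open import Data.Product using (Σ; _,_; proj₁; proj₂) renaming (_×_ to _∧_)

module CategoryReasoning {o ℓ : Level} (C : Category o ℓ) where
  open Category C

  pullˡ : ∀ {A B E F} {a : E ⇒ F} {b : B ⇒ E} {c : B ⇒ F} {f : A ⇒ B} →
          a ∘ b ≡ c → a ∘ (b ∘ f) ≡ c ∘ f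
  pullˡ {f = f} p = trans (sym assoc) (cong (_∘ f) p)

  pullʳ : ∀ {A B E F} {a : E ⇒ F} {b : B ⇒ E} {f : A ⇒ B} {g : A ⇒ E} →
          b ∘ f ≡ g → (a ∘ b) ∘ f ≡ a ∘ g
  pullʳ {a = a} p = trans assoc (cong (a ∘_) p)

module ProductLemmas {o ℓ : Level} (C : Category o ℓ) (P : BinaryProducts C) where
  open Category C
  open BinaryProducts P
  open CategoryReasoning C

  ⟨⟩∘ : ∀ {V W A B} {f : W ⇒ A} {g : W ⇒ B} {h : V ⇒ W} → ⟨ f , g ⟩ ∘ h ≡ ⟨ f ∘ h , g ∘ h ⟩
  ⟨⟩∘ = ⟨⟩-unique _ (pullˡ fst-⟨⟩) (pullˡ snd-⟨⟩)

  ⁂∘⟨⟩ : ∀ {W A B A' B'} {f : A ⇒ A'} {g : B ⇒ B'} {a : W ⇒ A} {b : W ⇒ B} →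
         (f ⁂ g) ∘ ⟨ a , b ⟩ ≡ ⟨ f ∘ a , g ∘ b ⟩
  ⁂∘⟨⟩ = trans ⟨⟩∘ (cong₂ ⟨_,_⟩ (pullʳ fst-⟨⟩) (pullʳ snd-⟨⟩))

  ⁂∘⁂ : ∀ {A B A' B' A'' B''} {f : A' ⇒ A''} {g : B' ⇒ B''} {h : A ⇒ A'} {k : B ⇒ B'} →
        (f ⁂ g) ∘ (h ⁂ k) ≡ (f ∘ h) ⁂ (g ∘ k)
  ⁂∘⁂ = trans ⁂∘⟨⟩ (cong₂ ⟨_,_⟩ (sym assoc) (sym assoc))

  ⁂-id : ∀ {A B} → id {A} ⁂ id {B} ≡ id
  ⁂-id = sym (⟨⟩-unique id (trans identityʳ (sym identityˡ)) (trans identityʳ (sym identityˡ)))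

  fst∘id⁂ : ∀ {A B B'} {g : B ⇒ B'} → fst ∘ (id {A} ⁂ g) ≡ fst
  fst∘id⁂ = trans fst-⟨⟩ identityˡ

  id⁂-∘ : ∀ {X A B E} {a : B ⇒ E} {b : A ⇒ B} → id {X} ⁂ (a ∘ b) ≡ (id ⁂ a) ∘ (id ⁂ b)
  id⁂-∘ = sym (trans ⁂∘⁂ (cong (_⁂ _) identityˡ))

  ⁂∘id⁂ : ∀ {A B B' A' B''} {f : A ⇒ A'} {g : B' ⇒ B''} {h : B ⇒ B'} →
          (f ⁂ g) ∘ (id ⁂ h) ≡ f ⁂ (g ∘ h)
  ⁂∘id⁂ = trans ⁂∘⁂ (cong (_⁂ _) identityʳ)

  id⁂∘⁂id : ∀ {A B A' B'} {f : A ⇒ A'} {g : B ⇒ B'} → (id ⁂ g) ∘ (f ⁂ id) ≡ f ⁂ g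
  id⁂∘⁂id = trans ⁂∘⁂ (cong₂ _⁂_ identityˡ identityʳ)

  id⁂∘⟨,id⟩ : ∀ {W X B} {r : W ⇒ X} {f : W ⇒ B} → (id ⁂ f) ∘ ⟨ r , id ⟩ ≡ ⟨ r , f ⟩
  id⁂∘⟨,id⟩ = trans ⁂∘⟨⟩ (cong₂ ⟨_,_⟩ identityˡ identityʳ)

  assocʳ-natural : ∀ {X Y B B'} {k : B ⇒ B'} →
                   assocʳ ∘ (id {X × Y} ⁂ k) ≡ (id ⁂ (id ⁂ k)) ∘ assocʳ
  assocʳ-natural {k = k} = begin
    assocʳ ∘ (id ⁂ k)                                          ≡⟨ ⟨⟩∘ ⟩
    ⟨ (fst ∘ fst) ∘ (id ⁂ k) , ⟨ snd ∘ fst , snd ⟩ ∘ (id ⁂ k) ⟩ ≡⟨ cong₂ ⟨_,_⟩ (pullʳ fst∘id⁂) (trans ⟨⟩∘ (cong₂ ⟨_,_⟩ (pullʳ fst∘id⁂) snd-⟨⟩)) ⟩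
    ⟨ fst ∘ fst , ⟨ snd ∘ fst , k ∘ snd ⟩ ⟩                     ≡⟨ cong₂ ⟨_,_⟩ (sym identityˡ) (sym (trans ⁂∘⟨⟩ (cong (⟨_, k ∘ snd ⟩) identityˡ))) ⟩
    ⟨ id ∘ (fst ∘ fst) , (id ⁂ k) ∘ ⟨ snd ∘ fst , snd ⟩ ⟩        ≡⟨ sym ⁂∘⟨⟩ ⟩
    (id ⁂ (id ⁂ k)) ∘ assocʳ                                   ∎
    where open ≡-Reasoning

module CoproductLemmas {o ℓ : Level} (C : Category o ℓ) (S : Coproducts C) where
  open Category C
  open Coproducts S
  open CategoryReasoning C

  ∘[] : ∀ {A B W V} {f : A ⇒ W} {g : B ⇒ W} {h : W ⇒ V} → h ∘ [ f , g ] ≡ [ h ∘ f , h ∘ g ]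
  ∘[] = []-unique _ (pullʳ inl-[]) (pullʳ inr-[])

  []∘⊕ : ∀ {A B A' B' W} {f : A' ⇒ W} {g : B' ⇒ W} {h : A ⇒ A'} {k : B ⇒ B'} →
         [ f , g ] ∘ (h ⊕ k) ≡ [ f ∘ h , g ∘ k ]
  []∘⊕ = trans ∘[] (cong₂ [_,_] (pullˡ inl-[]) (pullˡ inr-[]))

  ⊕∘⊕ : ∀ {A B A' B' A'' B''} {f : A' ⇒ A''} {g : B' ⇒ B''} {h : A ⇒ A'} {k : B ⇒ B'} →
        (f ⊕ g) ∘ (h ⊕ k) ≡ (f ∘ h) ⊕ (g ∘ k)
  ⊕∘⊕ = trans []∘⊕ (cong₂ [_,_] assoc assoc)

  ⊕-id : ∀ {A B} → id {A} ⊕ id {B} ≡ id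
  ⊕-id = sym ([]-unique id (trans identityˡ (sym identityʳ)) (trans identityˡ (sym identityʳ)))

  ⊕id∘⊕id : ∀ {A B E Z} {m : B ⇒ E} {u : A ⇒ B} → (m ⊕ id {Z}) ∘ (u ⊕ id) ≡ (m ∘ u) ⊕ id
  ⊕id∘⊕id = trans ⊕∘⊕ (cong (_ ⊕_) identityˡ)

  id⊕∘⊕id : ∀ {A B A' B'} {a : A ⇒ A'} {b : B ⇒ B'} → (id ⊕ b) ∘ (a ⊕ id) ≡ a ⊕ b
  id⊕∘⊕id = trans ⊕∘⊕ (cong₂ _⊕_ identityˡ identityʳ)

  ⊕-interchange : ∀ {A B A' B'} {a : A ⇒ A'} {b : B ⇒ B'} → (id ⊕ b) ∘ (a ⊕ id) ≡ (a ⊕ id) ∘ (id ⊕ b)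
  ⊕-interchange = trans id⊕∘⊕id (sym (trans ⊕∘⊕ (cong₂ _⊕_ identityʳ identityˡ)))

module DistributivityLemmas {o ℓ : Level} (C : Category o ℓ) (P : BinaryProducts C)
                            (S : Coproducts C) (D : Distributivity C P S) where
  open Category C
  open BinaryProducts P
  open Coproducts S
  open Distributivity D
  open CategoryReasoning C
  open ProductLemmas C P
  open CoproductLemmas C S
  open ≡-Reasoning

  dstr⁻¹ : ∀ {X B Z} → X × B + X × Z ⇒ X × (B + Z)
  dstr⁻¹ = [ id ⁂ inl , id ⁂ inr ]

  dstr-transposeˡ : ∀ {W X B Z} {a : W ⇒ X × B + X × Z} {b : W ⇒ X × (B + Z)} →
                    dstr⁻¹ ∘ a ≡ b → a ≡ dstr ∘ b
  dstr-transposeˡ {a = a} p = trans (sym identityˡ) (trans (cong (_∘ a) (sym dstr-inverseˡ)) (pullʳ p))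

  dstr-transposeʳ : ∀ {W X B Z} {a : X × (B + Z) ⇒ W} {b : X × B + X × Z ⇒ W} →
                    a ∘ dstr⁻¹ ≡ b → a ≡ b ∘ dstr
  dstr-transposeʳ {a = a} p = trans (sym identityʳ) (trans (cong (a ∘_) (sym dstr-inverseʳ)) (pullˡ p))

  dstr-commute : ∀ {X B Z X' B' Z'} {x : X × (B + Z) ⇒ X' × (B' + Z')} {y : X × B + X × Z ⇒ X' × B' + X' × Z'} →
                 x ∘ dstr⁻¹ ≡ dstr⁻¹ ∘ y → dstr ∘ x ≡ y ∘ dstr
  dstr-commute p = sym (dstr-transposeˡ (trans (sym assoc) (sym (dstr-transposeʳ p))))

  dstr∘id⁂inl : ∀ {X B Z} → dstr {X} {B} {Z} ∘ (id ⁂ inl) ≡ inl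
  dstr∘id⁂inl = sym (dstr-transposeˡ inl-[])

  dstr∘id⁂inr : ∀ {X B Z} → dstr {X} {B} {Z} ∘ (id ⁂ inr) ≡ inr
  dstr∘id⁂inr = sym (dstr-transposeˡ inr-[])

  fst∘dstr⁻¹ : ∀ {X B Z} → fst ∘ dstr⁻¹ {X} {B} {Z} ≡ [ fst , fst ]
  fst∘dstr⁻¹ = trans ∘[] (cong₂ [_,_] fst∘id⁂ fst∘id⁂)

  snd∘dstr⁻¹ : ∀ {X B Z} → snd ∘ dstr⁻¹ {X} {B} {Z} ≡ snd ⊕ snd
  snd∘dstr⁻¹ = trans ∘[] (cong₂ [_,_] snd-⟨⟩ snd-⟨⟩)

  [fst,fst]∘dstr : ∀ {X B Z} → [ fst , fst ] ∘ dstr {X} {B} {Z} ≡ fst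
  [fst,fst]∘dstr = sym (dstr-transposeʳ fst∘dstr⁻¹)

  snd⊕snd∘dstr : ∀ {X B Z} → (snd ⊕ snd) ∘ dstr {X} {B} {Z} ≡ snd
  snd⊕snd∘dstr = sym (dstr-transposeʳ snd∘dstr⁻¹)

  dstr-natural : ∀ {X X' B B' Z Z'} {a : X ⇒ X'} {b : B ⇒ B'} {c : Z ⇒ Z'} →
                 dstr ∘ (a ⁂ (b ⊕ c)) ≡ ((a ⁂ b) ⊕ (a ⁂ c)) ∘ dstr
  dstr-natural = dstr-commute (trans ∘[] (trans (cong₂ [_,_] (on-summand inl-[]) (on-summand inr-[])) (sym []∘⊕)))
    where
      on-summand : ∀ {X X' E E' U U'} {a : X ⇒ X'} {b : E ⇒ E'} {b' : U ⇒ U'} {i : E ⇒ U} {j : E' ⇒ U'} →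
                   b' ∘ i ≡ j ∘ b → (a ⁂ b') ∘ (id ⁂ i) ≡ (id ⁂ j) ∘ (a ⁂ b)
      on-summand p = trans ⁂∘⁂ (trans (cong₂ _⁂_ (trans identityʳ (sym identityˡ)) p) (sym ⁂∘⁂))

  dstr∘id⁂⊕id : ∀ {X Y B B' Z} {w : B ⇒ B'} {g : Y ⇒ B + Z} →
                dstr ∘ (id {X} ⁂ (w ⊕ id) ∘ g) ≡ ((id ⁂ w) ⊕ id) ∘ dstr ∘ (id ⁂ g)
  dstr∘id⁂⊕id {w = w} = trans (cong (dstr ∘_) id⁂-∘) (trans (pullˡ (trans dstr-natural (cong (λ x → ((id ⁂ w) ⊕ x) ∘ dstr) ⁂-id))) assoc)

  dstr-assocʳ : ∀ {X Y A B} → dstr ∘ ((id ⁂ dstr) ∘ assocʳ {X} {Y} {A + B}) ≡ (assocʳ ⊕ assocʳ) ∘ dstr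
  dstr-assocʳ = dstr-commute (trans ∘[] (trans (cong₂ [_,_] (on-summand dstr∘id⁂inl) (on-summand dstr∘id⁂inr)) (sym []∘⊕)))
    where
      on-summand : ∀ {X Y A B E} {j : E ⇒ A + B} {j' : Y × E ⇒ Y × A + Y × B} →
                   dstr ∘ (id ⁂ j) ≡ j' → ((id {X} ⁂ dstr) ∘ assocʳ) ∘ (id ⁂ j) ≡ (id ⁂ j') ∘ assocʳ
      on-summand {j = j} {j'} p = begin
        ((id ⁂ dstr) ∘ assocʳ) ∘ (id ⁂ j)           ≡⟨ pullʳ assocʳ-natural ⟩
        (id ⁂ dstr) ∘ ((id ⁂ (id ⁂ j)) ∘ assocʳ)    ≡⟨ pullˡ (sym id⁂-∘) ⟩
        (id ⁂ (dstr ∘ (id ⁂ j))) ∘ assocʳ           ≡⟨ cong (λ x → (id ⁂ x) ∘ assocʳ) p ⟩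
        (id ⁂ j') ∘ assocʳ                          ∎

  dstr⁻¹∘id⊕⟨,id⟩ : ∀ {W X B} {r : W ⇒ X} →
                    dstr⁻¹ ∘ (id ⊕ ⟨ r , id ⟩) ≡ ⟨ [ fst , r ] , snd {X} {B} ⊕ id ⟩
  dstr⁻¹∘id⊕⟨,id⟩ = ⟨⟩-unique _
    (trans (pullˡ fst∘dstr⁻¹) (trans []∘⊕ (cong₂ [_,_] identityʳ fst-⟨⟩)))
    (trans (pullˡ snd∘dstr⁻¹) (trans ⊕∘⊕ (cong₂ _⊕_ identityʳ snd-⟨⟩)))

  dstr-over : ∀ {W X B} {r : W ⇒ X} {f : W ⇒ X × B + W} → [ fst , r ] ∘ f ≡ r →
              (id ⊕ ⟨ r , id ⟩) ∘ f ≡ dstr ∘ ⟨ r , (snd ⊕ id) ∘ f ⟩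
  dstr-over p = dstr-transposeˡ (trans (pullˡ dstr⁻¹∘id⊕⟨,id⟩) (trans ⟨⟩∘ (cong (⟨_, _ ⟩) p)))

module IterationAlgebras {o ℓ : Level} (C : Category o ℓ) (S : Coproducts C) where
  open Category C
  open Coproducts S
  open CategoryReasoning C
  open CoproductLemmas C S

  infix 10 _†[_]
  _†[_] : ∀ {A Z} → Z ⇒ A + Z → UIA C S A → Z ⇒ A
  f †[ α ] = UIA._† α f

  id-isUIAMorphism : ∀ {A} {α : UIA C S A} → IsUIAMorphism C S α α id
  id-isUIAMorphism {α = α} f = trans identityˡ (cong (_†[ α ]) (sym (trans (cong (_∘ f) ⊕-id) identityˡ)))

  ∘-isUIAMorphism : ∀ {A B E} {α : UIA C S A} {β : UIA C S B} {γ : UIA C S E} {m : A ⇒ B} {n : B ⇒ E} →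
                    IsUIAMorphism C S α β m → IsUIAMorphism C S β γ n → IsUIAMorphism C S α γ (n ∘ m)
  ∘-isUIAMorphism {α = α} {β} {γ} {m} {n} m-mor n-mor f = begin
    (n ∘ m) ∘ f †[ α ]                 ≡⟨ assoc ⟩
    n ∘ (m ∘ f †[ α ])                 ≡⟨ cong (n ∘_) (m-mor f) ⟩
    n ∘ ((m ⊕ id) ∘ f) †[ β ]          ≡⟨ n-mor _ ⟩
    ((n ⊕ id) ∘ (m ⊕ id) ∘ f) †[ γ ]   ≡⟨ cong (_†[ γ ]) (pullˡ ⊕id∘⊕id) ⟩
    ((n ∘ m ⊕ id) ∘ f) †[ γ ]          ∎
    where open ≡-Reasoning

module Kleisli {o ℓ : Level} (C : Category o ℓ) (S : Coproducts C) (P : BinaryProducts C)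
               (T : Terminal C) (D : Distributivity C P S) (Kf : (X : Category.Obj C) → FreeUIA C S X) where
  open Category C
  open Induced C S P T D Kf
  open IterationAlgebras C S

  alg : ∀ X → UIA C S (K X)
  alg X = FreeUIA.alg (Kf X)

  *-isUIAMorphism : ∀ {X Y} (f : X ⇒ K Y) → IsUIAMorphism C S (alg X) (alg Y) (f *)
  *-isUIAMorphism {X} {Y} f = proj₁ (proj₁ (proj₂ (FreeUIA.free (Kf X) (alg Y) f)))

  *∘η : ∀ {X Y} (f : X ⇒ K Y) → (f *) ∘ η ≡ f
  *∘η {X} {Y} f = proj₂ (proj₁ (proj₂ (FreeUIA.free (Kf X) (alg Y) f)))

  *-unique : ∀ {X Y} (f : X ⇒ K Y) (m : K X ⇒ K Y) → IsUIAMorphism C S (alg X) (alg Y) m → m ∘ η ≡ f → m ≡ f *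
  *-unique {X} {Y} f m m-mor m∘η = proj₂ (proj₂ (FreeUIA.free (Kf X) (alg Y) f)) m (m-mor , m∘η)

  Kmap∘η : ∀ {X Y} (f : X ⇒ Y) → Kmap f ∘ η ≡ η ∘ f
  Kmap∘η f = *∘η (η ∘ f)

  η* : ∀ {X} → η {X} * ≡ id
  η* {X} = sym (*-unique η id (id-isUIAMorphism {α = alg X}) identityˡ)

  *-assoc : ∀ {X Y W} (f : X ⇒ K Y) (g : Y ⇒ K W) → ((g *) ∘ f) * ≡ (g *) ∘ (f *)
  *-assoc {X} {Y} {W} f g =
    sym (*-unique _ _ (∘-isUIAMorphism {α = alg X} {β = alg Y} {γ = alg W} (*-isUIAMorphism f) (*-isUIAMorphism g))
                      (trans assoc (cong ((g *) ∘_) (*∘η f))))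

  monadLaws : MonadLaws
  monadLaws = *∘η , η* , *-assoc

module StrongMaps {o ℓ : Level} (C : Category o ℓ) (P : BinaryProducts C)
                  (S : Coproducts C) (D : Distributivity C P S) where
  open Category C
  open BinaryProducts P
  open Coproducts S
  open Distributivity D
  open CategoryReasoning C
  open ProductLemmas C P
  open CoproductLemmas C S
  open DistributivityLemmas C P S D
  open IterationAlgebras C S
  open ≡-Reasoning

  record IsStrongUIAMorphism {X A B} (β : UIA C S B) (α : UIA C S A) (u : X × B ⇒ A) : Set (o ⊔ ℓ) where
    constructor isStrong
    field
      preserves-iteration : ∀ {Z} (h : Z ⇒ B + Z) →
                            u ∘ (id ⁂ h †[ β ]) ≡ ((u ⊕ id) ∘ dstr ∘ (id ⁂ h)) †[ α ]
  open IsStrongUIAMorphism public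

  snd-† : ∀ {X B Z} {β : UIA C S B} (h : Z ⇒ B + Z) →
          ((snd ⊕ id) ∘ dstr ∘ (id {X} ⁂ h)) †[ β ] ≡ h †[ β ] ∘ snd
  snd-† {β = β} h = UIA.uniformity β (begin
    (id ⊕ snd) ∘ (snd ⊕ id) ∘ dstr ∘ (id ⁂ h) ≡⟨ pullˡ id⊕∘⊕id ⟩
    (snd ⊕ snd) ∘ dstr ∘ (id ⁂ h)              ≡⟨ pullˡ snd⊕snd∘dstr ⟩
    snd ∘ (id ⁂ h)                            ≡⟨ snd-⟨⟩ ⟩
    h ∘ snd                                   ∎)

  snd-isStrong : ∀ {X B} {β : UIA C S B} → IsStrongUIAMorphism β β (snd {X} {B})
  snd-isStrong {β = β} = isStrong λ h → trans snd-⟨⟩ (sym (snd-† {β = β} h))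

  ∘-isStrong : ∀ {X A A' B} {β : UIA C S B} {α : UIA C S A} {α' : UIA C S A'} {m : A ⇒ A'} {u : X × B ⇒ A} →
               IsUIAMorphism C S α α' m → IsStrongUIAMorphism β α u → IsStrongUIAMorphism β α' (m ∘ u)
  ∘-isStrong {β = β} {α} {α'} {m} {u} m-mor u-strong = isStrong λ h → begin
    (m ∘ u) ∘ (id ⁂ h †[ β ])                            ≡⟨ pullʳ (preserves-iteration u-strong h) ⟩
    m ∘ ((u ⊕ id) ∘ dstr ∘ (id ⁂ h)) †[ α ]              ≡⟨ m-mor _ ⟩
    ((m ⊕ id) ∘ (u ⊕ id) ∘ dstr ∘ (id ⁂ h)) †[ α' ]      ≡⟨ cong (_†[ α' ]) (pullˡ ⊕id∘⊕id) ⟩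
    ((m ∘ u ⊕ id) ∘ dstr ∘ (id ⁂ h)) †[ α' ]             ∎

  isStrong-∘⁂ : ∀ {X X' A B B'} {α : UIA C S A} {β : UIA C S B} {β' : UIA C S B'} {u : X' × B' ⇒ A} {m : B ⇒ B'} →
                IsStrongUIAMorphism β' α u → IsUIAMorphism C S β β' m → (f : X ⇒ X') →
                IsStrongUIAMorphism β α (u ∘ (f ⁂ m))
  isStrong-∘⁂ {B = B} {α = α} {β} {β'} {u} {m} u-strong m-mor f = isStrong preserves
    where
      preserves : ∀ {Z} (h : Z ⇒ B + Z) → (u ∘ (f ⁂ m)) ∘ (id ⁂ h †[ β ]) ≡ ((u ∘ (f ⁂ m) ⊕ id) ∘ dstr ∘ (id ⁂ h)) †[ α ]
      preserves h = begin
        (u ∘ (f ⁂ m)) ∘ (id ⁂ h †[ β ])                        ≡⟨ pullʳ ⁂∘id⁂ ⟩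
        u ∘ (f ⁂ m ∘ h †[ β ])                                 ≡⟨ cong (λ x → u ∘ (f ⁂ x)) (m-mor h) ⟩
        u ∘ (f ⁂ k †[ β' ])                                    ≡⟨ cong (u ∘_) (sym id⁂∘⁂id) ⟩
        u ∘ ((id ⁂ k †[ β' ]) ∘ (f ⁂ id))                      ≡⟨ pullˡ (preserves-iteration u-strong k) ⟩
        ((u ⊕ id) ∘ dstr ∘ (id ⁂ k)) †[ α ] ∘ (f ⁂ id)         ≡⟨ sym (UIA.uniformity α square) ⟩
        ((u ∘ (f ⁂ m) ⊕ id) ∘ dstr ∘ (id ⁂ h)) †[ α ]          ∎
        where
          k = (m ⊕ id) ∘ h
          square : (id ⊕ (f ⁂ id)) ∘ (u ∘ (f ⁂ m) ⊕ id) ∘ dstr ∘ (id ⁂ h) ≡ ((u ⊕ id) ∘ dstr ∘ (id ⁂ k)) ∘ (f ⁂ id)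
          square = begin
            (id ⊕ (f ⁂ id)) ∘ (u ∘ (f ⁂ m) ⊕ id) ∘ dstr ∘ (id ⁂ h) ≡⟨ pullˡ (trans id⊕∘⊕id (sym (trans ⊕∘⊕ (cong (u ∘ (f ⁂ m) ⊕_) identityˡ)))) ⟩
            ((u ⊕ id) ∘ ((f ⁂ m) ⊕ (f ⁂ id))) ∘ dstr ∘ (id ⁂ h)  ≡⟨ pullʳ (pullˡ (sym dstr-natural)) ⟩
            (u ⊕ id) ∘ (dstr ∘ (f ⁂ (m ⊕ id))) ∘ (id ⁂ h)        ≡⟨ cong ((u ⊕ id) ∘_) (pullʳ ⁂∘id⁂) ⟩
            (u ⊕ id) ∘ dstr ∘ (f ⁂ k)                            ≡⟨ cong (λ x → (u ⊕ id) ∘ dstr ∘ x) (sym id⁂∘⁂id) ⟩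
            (u ⊕ id) ∘ dstr ∘ (id ⁂ k) ∘ (f ⁂ id)                ≡⟨ cong ((u ⊕ id) ∘_) (sym assoc) ⟩
            (u ⊕ id) ∘ (dstr ∘ (id ⁂ k)) ∘ (f ⁂ id)              ≡⟨ sym assoc ⟩
            ((u ⊕ id) ∘ dstr ∘ (id ⁂ k)) ∘ (f ⁂ id)              ∎

  isStrong-assocʳ : ∀ {X Y A B B'} {α : UIA C S A} {β : UIA C S B} {β' : UIA C S B'}
                    {v : X × B' ⇒ A} {w : Y × B ⇒ B'} →
                    IsStrongUIAMorphism β' α v → IsStrongUIAMorphism β β' w →
                    IsStrongUIAMorphism β α (v ∘ (id ⁂ w) ∘ assocʳ)
  isStrong-assocʳ {B = B} {α = α} {β} {β'} {v} {w} v-strong w-strong = isStrong preserves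
    where
      u = v ∘ (id ⁂ w) ∘ assocʳ
      V = v ∘ (id ⁂ w)

      square : ∀ {Z} (h : Z ⇒ B + Z) →
               (id ⊕ assocʳ) ∘ (u ⊕ id) ∘ dstr ∘ (id ⁂ h) ≡ ((v ⊕ id) ∘ dstr ∘ (id ⁂ (w ⊕ id) ∘ dstr ∘ (id ⁂ h))) ∘ assocʳ
      square h = begin
        (id ⊕ assocʳ) ∘ (u ⊕ id) ∘ dstr ∘ (id ⁂ h)                 ≡⟨ pullˡ (trans id⊕∘⊕id (sym (trans ⊕∘⊕ (cong₂ _⊕_ assoc identityˡ)))) ⟩
        ((V ⊕ id) ∘ (assocʳ ⊕ assocʳ)) ∘ dstr ∘ (id ⁂ h)           ≡⟨ pullʳ (pullˡ (sym dstr-assocʳ)) ⟩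
        (V ⊕ id) ∘ (dstr ∘ (id ⁂ dstr) ∘ assocʳ) ∘ (id ⁂ h)        ≡⟨ cong ((V ⊕ id) ∘_) (pullʳ (pullʳ assocʳ-natural)) ⟩
        (V ⊕ id) ∘ dstr ∘ (id ⁂ dstr) ∘ (id ⁂ (id ⁂ h)) ∘ assocʳ   ≡⟨ cong (λ x → (V ⊕ id) ∘ dstr ∘ x) (pullˡ (sym id⁂-∘)) ⟩
        (V ⊕ id) ∘ dstr ∘ (id ⁂ g) ∘ assocʳ                        ≡⟨ sym (pullˡ ⊕id∘⊕id) ⟩
        (v ⊕ id) ∘ ((id ⁂ w) ⊕ id) ∘ dstr ∘ (id ⁂ g) ∘ assocʳ      ≡⟨ cong ((v ⊕ id) ∘_) (trans (cong (((id ⁂ w) ⊕ id) ∘_) (sym assoc)) (sym assoc)) ⟩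
        (v ⊕ id) ∘ (((id ⁂ w) ⊕ id) ∘ dstr ∘ (id ⁂ g)) ∘ assocʳ    ≡⟨ cong (λ x → (v ⊕ id) ∘ x ∘ assocʳ) (sym dstr∘id⁂⊕id) ⟩
        (v ⊕ id) ∘ (dstr ∘ (id ⁂ (w ⊕ id) ∘ g)) ∘ assocʳ           ≡⟨ sym assoc ⟩
        ((v ⊕ id) ∘ dstr ∘ (id ⁂ (w ⊕ id) ∘ g)) ∘ assocʳ           ∎
        where g = dstr ∘ (id ⁂ h)

      preserves : ∀ {Z} (h : Z ⇒ B + Z) → u ∘ (id ⁂ h †[ β ]) ≡ ((u ⊕ id) ∘ dstr ∘ (id ⁂ h)) †[ α ]
      preserves h = begin
        u ∘ (id ⁂ h †[ β ])                                ≡⟨ pullʳ (pullʳ assocʳ-natural) ⟩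
        v ∘ (id ⁂ w) ∘ (id ⁂ (id ⁂ h †[ β ])) ∘ assocʳ     ≡⟨ cong (v ∘_) (pullˡ (sym id⁂-∘)) ⟩
        v ∘ (id ⁂ w ∘ (id ⁂ h †[ β ])) ∘ assocʳ            ≡⟨ cong (λ x → v ∘ (id ⁂ x) ∘ assocʳ) (preserves-iteration w-strong h) ⟩
        v ∘ (id ⁂ k †[ β' ]) ∘ assocʳ                      ≡⟨ pullˡ (preserves-iteration v-strong k) ⟩
        ((v ⊕ id) ∘ dstr ∘ (id ⁂ k)) †[ α ] ∘ assocʳ       ≡⟨ sym (UIA.uniformity α (square h)) ⟩
        ((u ⊕ id) ∘ dstr ∘ (id ⁂ h)) †[ α ]                ∎
        where k = (w ⊕ id) ∘ dstr ∘ (id ⁂ h)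

  -- for A = KY this is inducedDagger, the slice structure in the definition of stability
  sliceDagger : ∀ {A} → UIA C S A → (X : Obj) → SliceDagger C S X (X × A)
  sliceDagger α X r f = ⟨ r , ((snd ⊕ id) ∘ f) †[ α ] ⟩

  sliceDagger-fixpoint : ∀ {X A Z} {α : UIA C S A} {r : Z ⇒ X} {f : Z ⇒ X × A + Z} → [ fst , r ] ∘ f ≡ r →
                         sliceDagger α X r f ≡ [ id , sliceDagger α X r f ] ∘ f
  sliceDagger-fixpoint {α = α} {r} {f} over = sym (⟨⟩-unique _
    (trans (pullˡ (trans ∘[] (cong₂ [_,_] identityʳ fst-⟨⟩))) over)
    (begin
      snd ∘ [ id , ⟨ r , f' †[ α ] ⟩ ] ∘ f   ≡⟨ pullˡ (trans ∘[] (cong₂ [_,_] identityʳ snd-⟨⟩)) ⟩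
      [ snd , f' †[ α ] ] ∘ f              ≡⟨ cong (_∘ f) (sym (trans []∘⊕ (cong₂ [_,_] identityˡ identityʳ))) ⟩
      ([ id , f' †[ α ] ] ∘ (snd ⊕ id)) ∘ f ≡⟨ trans assoc (sym (UIA.fixpoint α)) ⟩
      f' †[ α ]                            ∎))
    where f' = (snd ⊕ id) ∘ f

  sliceDagger-uniformity : ∀ {X A Z W} {α : UIA C S A} {r : Z ⇒ X} {t : W ⇒ X}
                           {f : Z ⇒ X × A + Z} {g : W ⇒ X × A + W} {h : Z ⇒ W} →
                           t ∘ h ≡ r → (id ⊕ h) ∘ f ≡ g ∘ h → sliceDagger α X r f ≡ sliceDagger α X t g ∘ h
  sliceDagger-uniformity {α = α} {f = f} {g} {h} t∘h square =
    trans (cong₂ ⟨_,_⟩ (sym t∘h) (UIA.uniformity α (begin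
      (id ⊕ h) ∘ (snd ⊕ id) ∘ f   ≡⟨ pullˡ ⊕-interchange ⟩
      ((snd ⊕ id) ∘ (id ⊕ h)) ∘ f ≡⟨ pullʳ square ⟩
      (snd ⊕ id) ∘ g ∘ h          ≡⟨ sym assoc ⟩
      ((snd ⊕ id) ∘ g) ∘ h        ∎))) (sym ⟨⟩∘)

  sliceUIA : ∀ {A} (α : UIA C S A) (X : Obj) → SliceUIA C S X (X × A) fst
  sliceUIA α X = record
    { dag        = sliceDagger α X
    ; over       = λ _ → fst-⟨⟩
    ; fixpoint   = sliceDagger-fixpoint {α = α}
    ; uniformity = λ _ _ t∘h square → sliceDagger-uniformity {α = α} t∘h square
    }

  IsSliceMorphism : ∀ {X A B} → UIA C S B → UIA C S A → X × B ⇒ X × A → Set (o ⊔ ℓ)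
  IsSliceMorphism {X} β α h = IsSliceUIAMorphism C S fst (sliceDagger β X) (sliceDagger α X) h

  id⁂†-sliceDagger : ∀ {X B Z} {β : UIA C S B} (k : Z ⇒ B + Z) →
                     id {X} ⁂ k †[ β ] ≡ sliceDagger β X fst (dstr ∘ (id ⁂ k))
  id⁂†-sliceDagger {β = β} k = cong₂ ⟨_,_⟩ identityˡ (sym (snd-† {β = β} k))

  [fst,fst]∘dstr∘id⁂ : ∀ {X B Z} (k : Z ⇒ B + Z) → [ fst , fst ] ∘ dstr ∘ (id {X} ⁂ k) ≡ fst
  [fst,fst]∘dstr∘id⁂ k = trans (pullˡ [fst,fst]∘dstr) fst∘id⁂

  isStrong-sliceDagger : ∀ {X A B W} {α : UIA C S A} {β : UIA C S B} {u : X × B ⇒ A} →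
                         IsStrongUIAMorphism β α u → {r : W ⇒ X} {f : W ⇒ X × B + W} → [ fst , r ] ∘ f ≡ r →
                         u ∘ sliceDagger β X r f ≡ ((u ⊕ id) ∘ f) †[ α ]
  isStrong-sliceDagger {α = α} {β} {u} u-strong {r} {f} over = begin
    u ∘ ⟨ r , f' †[ β ] ⟩                             ≡⟨ cong (u ∘_) (sym id⁂∘⟨,id⟩) ⟩
    u ∘ (id ⁂ f' †[ β ]) ∘ ⟨ r , id ⟩                 ≡⟨ pullˡ (preserves-iteration u-strong f') ⟩
    ((u ⊕ id) ∘ dstr ∘ (id ⁂ f')) †[ α ] ∘ ⟨ r , id ⟩ ≡⟨ sym (UIA.uniformity α square) ⟩
    ((u ⊕ id) ∘ f) †[ α ]                             ∎
    where
      f' = (snd ⊕ id) ∘ f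
      square : (id ⊕ ⟨ r , id ⟩) ∘ (u ⊕ id) ∘ f ≡ ((u ⊕ id) ∘ dstr ∘ (id ⁂ f')) ∘ ⟨ r , id ⟩
      square = begin
        (id ⊕ ⟨ r , id ⟩) ∘ (u ⊕ id) ∘ f         ≡⟨ pullˡ ⊕-interchange ⟩
        ((u ⊕ id) ∘ (id ⊕ ⟨ r , id ⟩)) ∘ f       ≡⟨ pullʳ (dstr-over over) ⟩
        (u ⊕ id) ∘ dstr ∘ ⟨ r , f' ⟩             ≡⟨ cong (λ x → (u ⊕ id) ∘ dstr ∘ x) (sym id⁂∘⟨,id⟩) ⟩
        (u ⊕ id) ∘ dstr ∘ (id ⁂ f') ∘ ⟨ r , id ⟩ ≡⟨ cong ((u ⊕ id) ∘_) (sym assoc) ⟩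
        (u ⊕ id) ∘ (dstr ∘ (id ⁂ f')) ∘ ⟨ r , id ⟩ ≡⟨ sym assoc ⟩
        ((u ⊕ id) ∘ dstr ∘ (id ⁂ f')) ∘ ⟨ r , id ⟩ ∎

  isStrong⇒isSliceMorphism : ∀ {X A B} {α : UIA C S A} {β : UIA C S B} {u : X × B ⇒ A} →
                             IsStrongUIAMorphism β α u → IsSliceMorphism β α ⟨ fst , u ⟩
  isStrong⇒isSliceMorphism {α = α} u-strong r f over =
    trans ⟨⟩∘ (cong₂ ⟨_,_⟩ fst-⟨⟩ (trans (isStrong-sliceDagger u-strong over)
      (cong (_†[ α ]) (sym (pullˡ (trans ⊕∘⊕ (cong₂ _⊕_ snd-⟨⟩ identityˡ)))))))

  isSliceMorphism⇒isStrong : ∀ {X A B} {α : UIA C S A} {β : UIA C S B} {h : X × B ⇒ X × A} →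
                             IsSliceMorphism β α h → IsStrongUIAMorphism β α (snd ∘ h)
  isSliceMorphism⇒isStrong {α = α} {β} {h} h-mor = isStrong λ k → begin
    (snd ∘ h) ∘ (id ⁂ k †[ β ])                              ≡⟨ pullʳ (cong (h ∘_) (id⁂†-sliceDagger {β = β} k)) ⟩
    snd ∘ h ∘ sliceDagger β _ fst (dstr ∘ (id ⁂ k))         ≡⟨ cong (snd ∘_) (h-mor fst _ ([fst,fst]∘dstr∘id⁂ k)) ⟩
    snd ∘ ⟨ fst , ((snd ⊕ id) ∘ (h ⊕ id) ∘ dstr ∘ (id ⁂ k)) †[ α ] ⟩ ≡⟨ snd-⟨⟩ ⟩
    ((snd ⊕ id) ∘ (h ⊕ id) ∘ dstr ∘ (id ⁂ k)) †[ α ]        ≡⟨ cong (_†[ α ]) (pullˡ ⊕id∘⊕id) ⟩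
    ((snd ∘ h ⊕ id) ∘ dstr ∘ (id ⁂ k)) †[ α ]               ∎

module StrongExtension {o ℓ : Level} (C : Category o ℓ) (P : BinaryProducts C)
                       (S : Coproducts C) (D : Distributivity C P S)
                       {Y : Category.Obj C} (F : FreeUIA C S Y) (stable : Stable C S P F) where
  open Category C
  open BinaryProducts P
  open FreeUIA F using (K; η) renaming (alg to β)
  open ProductLemmas C P
  open StrongMaps C P S D

  module _ (X : Obj) {A : Obj} (α : UIA C S A) where

    strongExtension : (g : X × Y ⇒ A) → Σ (X × K ⇒ A) λ u → IsStrongUIAMorphism β α u ∧ (u ∘ (id ⁂ η) ≡ g)
    strongExtension g with stable X (sliceUIA α X) ⟨ fst , g ⟩ fst-⟨⟩
    ... | h , (_ , h-mor , h∘id⁂η) , _ =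
      snd ∘ h , isSliceMorphism⇒isStrong h-mor , trans assoc (trans (cong (snd ∘_) h∘id⁂η) snd-⟨⟩)

    isStrong-unique : ∀ {u v : X × K ⇒ A} → IsStrongUIAMorphism β α u → IsStrongUIAMorphism β α v →
                      u ∘ (id ⁂ η) ≡ v ∘ (id ⁂ η) → u ≡ v
    isStrong-unique {u} {v} u-strong v-strong u≡v =
      trans (sym snd-⟨⟩) (trans (cong (snd ∘_) (trans ⟨fst,u⟩≡h (sym ⟨fst,v⟩≡h))) snd-⟨⟩)
      where
        ⟨fst,-⟩∘id⁂η : ∀ w → w ∘ (id ⁂ η) ≡ u ∘ (id ⁂ η) → ⟨ fst , w ⟩ ∘ (id ⁂ η) ≡ ⟨ fst , u ∘ (id ⁂ η) ⟩
        ⟨fst,-⟩∘id⁂η w p = trans ⟨⟩∘ (cong₂ ⟨_,_⟩ fst∘id⁂ p)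
        uniqueness = proj₂ (proj₂ (stable X (sliceUIA α X) ⟨ fst , u ∘ (id ⁂ η) ⟩ fst-⟨⟩))
        ⟨fst,u⟩≡h = uniqueness ⟨ fst , u ⟩ (fst-⟨⟩ , isStrong⇒isSliceMorphism u-strong , ⟨fst,-⟩∘id⁂η u refl)
        ⟨fst,v⟩≡h = uniqueness ⟨ fst , v ⟩ (fst-⟨⟩ , isStrong⇒isSliceMorphism v-strong , ⟨fst,-⟩∘id⁂η v (sym u≡v))

module StrongMonad {o ℓ : Level} (C : Category o ℓ) (T : Terminal C) (P : BinaryProducts C)
                   (S : Coproducts C) (D : Distributivity C P S)
                   (Kf : (X : Category.Obj C) → FreeUIA C S X) (stable : ∀ Y → Stable C S P (Kf Y)) where
  open Category C
  open BinaryProducts P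
  open Induced C S P T D Kf
  open Kleisli C S P T D Kf
  open CategoryReasoning C
  open ProductLemmas C P
  open StrongMaps C P S D
  open ≡-Reasoning

  module Ext (Y : Obj) = StrongExtension C P S D (Kf Y) (stable Y)

  IsStrong : ∀ {X Y A} → UIA C S A → X × K Y ⇒ A → Set (o ⊔ ℓ)
  IsStrong {Y = Y} α u = IsStrongUIAMorphism (alg Y) α u

  strong-ext : ∀ {X Y A} {α : UIA C S A} {u v : X × K Y ⇒ A} → IsStrong α u → IsStrong α v →
               u ∘ (id ⁂ η) ≡ v ∘ (id ⁂ η) → u ≡ v
  strong-ext {X} {Y} {α = α} = Ext.isStrong-unique Y X α

  τ : Strength
  τ X Y = proj₁ (Ext.strongExtension Y X (alg (X × Y)) η)

  τ-isStrong : ∀ {X Y} → IsStrong (alg (X × Y)) (τ X Y)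
  τ-isStrong {X} {Y} = proj₁ (proj₂ (Ext.strongExtension Y X (alg (X × Y)) η))

  τ∘id⁂η : ∀ {X Y} → τ X Y ∘ (id ⁂ η) ≡ η
  τ∘id⁂η {X} {Y} = proj₂ (proj₂ (Ext.strongExtension Y X (alg (X × Y)) η))

  τ-unique : ∀ {X Y} {t : X × K Y ⇒ K (X × Y)} → IsStrong (alg (X × Y)) t → t ∘ (id ⁂ η) ≡ η → t ≡ τ X Y
  τ-unique t-strong t∘id⁂η = strong-ext t-strong τ-isStrong (trans t∘id⁂η (sym τ∘id⁂η))

  τ-natural : ∀ {X X' Y Y'} (f : X ⇒ X') (g : Y ⇒ Y') → τ X' Y' ∘ (f ⁂ Kmap g) ≡ Kmap (f ⁂ g) ∘ τ X Y
  τ-natural {X} {X'} {Y} {Y'} f g =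
    strong-ext (isStrong-∘⁂ τ-isStrong (*-isUIAMorphism (η ∘ g)) f)
               (∘-isStrong (*-isUIAMorphism (η ∘ (f ⁂ g))) τ-isStrong) (begin
      (τ X' Y' ∘ (f ⁂ Kmap g)) ∘ (id ⁂ η) ≡⟨ pullʳ (trans ⁂∘id⁂ (trans (cong (f ⁂_) (Kmap∘η g)) (sym id⁂η∘⁂))) ⟩
      τ X' Y' ∘ (id ⁂ η) ∘ (f ⁂ g)        ≡⟨ pullˡ τ∘id⁂η ⟩
      η ∘ (f ⁂ g)                         ≡⟨ sym (Kmap∘η (f ⁂ g)) ⟩
      Kmap (f ⁂ g) ∘ η                    ≡⟨ cong (Kmap (f ⁂ g) ∘_) (sym τ∘id⁂η) ⟩
      Kmap (f ⁂ g) ∘ τ X Y ∘ (id ⁂ η)     ≡⟨ sym assoc ⟩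
      (Kmap (f ⁂ g) ∘ τ X Y) ∘ (id ⁂ η)   ∎)
    where
      id⁂η∘⁂ : (id ⁂ η) ∘ (f ⁂ g) ≡ f ⁂ η ∘ g
      id⁂η∘⁂ = trans ⁂∘⁂ (cong (_⁂ _) identityˡ)

  τ-snd : ∀ {X Y} → Kmap snd ∘ τ X Y ≡ snd
  τ-snd {X} {Y} = strong-ext (∘-isStrong (*-isUIAMorphism (η ∘ snd)) τ-isStrong) snd-isStrong (begin
    (Kmap snd ∘ τ X Y) ∘ (id ⁂ η) ≡⟨ pullʳ τ∘id⁂η ⟩
    Kmap snd ∘ η                  ≡⟨ Kmap∘η snd ⟩
    η ∘ snd                       ≡⟨ sym snd-⟨⟩ ⟩
    snd ∘ (id ⁂ η)                ∎)

  τ-assocʳ : ∀ {X Y W} → Kmap assocʳ ∘ τ (X × Y) W ≡ τ X (Y × W) ∘ (id ⁂ τ Y W) ∘ assocʳ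
  τ-assocʳ {X} {Y} {W} =
    strong-ext (∘-isStrong (*-isUIAMorphism (η ∘ assocʳ)) τ-isStrong)
               (isStrong-assocʳ τ-isStrong τ-isStrong) (begin
      (Kmap assocʳ ∘ τ (X × Y) W) ∘ (id ⁂ η)         ≡⟨ pullʳ τ∘id⁂η ⟩
      Kmap assocʳ ∘ η                                ≡⟨ Kmap∘η assocʳ ⟩
      η ∘ assocʳ                                     ≡⟨ trans (cong (_∘ assocʳ) (sym τ∘id⁂η)) assoc ⟩
      τ' ∘ (id ⁂ η) ∘ assocʳ                         ≡⟨ cong (λ x → τ' ∘ (id ⁂ x) ∘ assocʳ) (sym τ∘id⁂η) ⟩
      τ' ∘ (id ⁂ τ Y W ∘ (id ⁂ η)) ∘ assocʳ          ≡⟨ cong (τ' ∘_) (trans (cong (_∘ assocʳ) id⁂-∘) (pullʳ (sym assocʳ-natural))) ⟩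
      τ' ∘ (id ⁂ τ Y W) ∘ assocʳ ∘ (id ⁂ η)          ≡⟨ trans (cong (τ' ∘_) (sym assoc)) (sym assoc) ⟩
      (τ' ∘ (id ⁂ τ Y W) ∘ assocʳ) ∘ (id ⁂ η)        ∎)
    where τ' = τ X (Y × W)

  τ-* : ∀ {X Y W} (f : Y ⇒ K W) → τ X W ∘ (id ⁂ (f *)) ≡ ((τ X W ∘ (id ⁂ f)) *) ∘ τ X Y
  τ-* {X} {Y} {W} f =
    strong-ext (isStrong-∘⁂ τ-isStrong (*-isUIAMorphism f) id)
               (∘-isStrong (*-isUIAMorphism (τ X W ∘ (id ⁂ f))) τ-isStrong) (begin
      (τ X W ∘ (id ⁂ (f *))) ∘ (id ⁂ η)    ≡⟨ pullʳ (trans ⁂∘id⁂ (cong (id ⁂_) (*∘η f))) ⟩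
      τ X W ∘ (id ⁂ f)                     ≡⟨ sym (*∘η (τ X W ∘ (id ⁂ f))) ⟩
      (τ X W ∘ (id ⁂ f)) * ∘ η             ≡⟨ cong ((τ X W ∘ (id ⁂ f)) * ∘_) (sym τ∘id⁂η) ⟩
      (τ X W ∘ (id ⁂ f)) * ∘ τ X Y ∘ (id ⁂ η)   ≡⟨ sym assoc ⟩
      ((τ X W ∘ (id ⁂ f)) * ∘ τ X Y) ∘ (id ⁂ η) ∎)

-- Extensivity, the natural number object and the exponentials are what the paper
-- needs to construct KX; with the free algebras given, they play no further role.
proposition5p7 : ∀ {o ℓ : Level} (C : Category o ℓ) (T : Terminal C) (P : BinaryProducts C)
    (S : Coproducts C) → Extensive C S → (D : Distributivity C P S)
    → (nno : StableNNO C T P) → ExponentialsBy C P (StableNNO.N nno)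
    → (Kf : (X : Category.Obj C) → FreeUIA C S X)
    → (∀ Y → Stable C S P (Kf Y))
    → Induced.Conclusion C S P T D Kf
proposition5p7 C T P S _ D _ _ Kf stable =
    monadLaws
  , τ
  , (τ-natural , τ-snd , τ-assocʳ , τ∘id⁂η , τ-*)
  , λ X Y → (τ∘id⁂η , preserves-iteration τ-isStrong) , λ t (t∘id⁂η , t-strong) → τ-unique (isStrong t-strong) t∘id⁂η
  where
    open Kleisli C S P T D Kf using (monadLaws)
    open StrongMaps C P S D using (isStrong; preserves-iteration)
    open StrongMonad C T P S D Kf stable
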